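{- Let $d\ge1$ and $l\ge 1$ be integers, let $n_1,\dots,n_d$ be positive integers, let $M\subset\mathcal{P}([d])$ be non-empty, and let $A\subset[n_1]\times\dots\times[n_d]$ have $M$-covering number at least $l$. Then $I_M(A)\ge \mathrm{c}_M(A)/|M|$.
   Context: $[k]=\{1,\dots,k\}$. For $B \subset [d]$, a $B$-subspace is a maximal subset $S$ of $[n_1]\times\dots\times[n_d]$ such that $x_i = y_i$ whenever $x,y\in S$ and $i \notin B$. For non-empty $M\subset\mathcal{P}([d])$, an $M$-subspace is a $B$-subspace for some $B\in M$. The $M$-covering number $\mathrm{c}_M(A)$ is the smallest nonnegative integer $k$ such that $A$ is contained in a union of $k$ $M$-subspaces. The $M$-independence number $I_M(A)$ is the largest size of a subset $A'\subset A$ such that no two distinct elements of $A'$ are contained in a common $M$-subspace. -}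

module Defs where

open import Data.Nat using (ℕ; _≤_; _*_)
open import Data.Fin using (Fin)
open import Data.Fin.Subset using (Subset; _∈_; _∉_)
open import Data.List using (List; length)
open import Data.List.Membership.Propositional using () renaming (_∈_ to _∈ˡ_)
open import Data.List.Relation.Unary.All using (All)
open import Data.List.Relation.Unary.Any using (Any)
open import Data.List.Relation.Unary.AllPairs using (AllPairs)
open import Data.Product using (Σ; _×_; ∃; ∃-syntax; proj₁; proj₂)
open import Relation.Binary.PropositionalEquality using (_≡_)
open import Relation.Nullary using (¬_)

-- Points of the grid [n_1] × … × [n_d] (coordinates 0-indexed: Fin (n i)).
Point : (d : ℕ) → (Fin d → ℕ) → Set
Point d n = (i : Fin d) → Fin (n i)

GridSet : (d : ℕ) → (Fin d → ℕ) → Set₁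
GridSet d n = Point d n → Set

-- The B-subspace through x: { y | y i = x i for all i ∉ B }.
-- Every B-subspace (maximal set whose elements agree outside B) is of this form.
InSubspace : {d : ℕ} {n : Fin d → ℕ} → Subset d → Point d n → Point d n → Set
InSubspace {d} B x y = (i : Fin d) → i ∉ B → y i ≡ x i

MSubspace : {d : ℕ} (n : Fin d → ℕ) → List (Subset d) → Set
MSubspace {d} n M = Σ (Subset d) λ B → (B ∈ˡ M) × Point d n

_∈S_ : {d : ℕ} {n : Fin d → ℕ} {M : List (Subset d)} → Point d n → MSubspace n M → Set
y ∈S S = InSubspace (proj₁ S) (proj₂ (proj₂ S)) y

IsCover : {d : ℕ} {n : Fin d → ℕ} (M : List (Subset d)) → GridSet d n → List (MSubspace n M) → Set
IsCover {d} {n} M A Ss = (a : Point d n) → A a → Any (λ S → a ∈S S) Ss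

IsCoveringNumber : {d : ℕ} {n : Fin d → ℕ} (M : List (Subset d)) → GridSet d n → ℕ → Set
IsCoveringNumber {d} {n} M A c =
  (Σ (List (MSubspace n M)) λ Ss → IsCover M A Ss × length Ss ≡ c)
  × ((Ss : List (MSubspace n M)) → IsCover M A Ss → c ≤ length Ss)

CommonMSubspace : {d : ℕ} {n : Fin d → ℕ} → List (Subset d) → Point d n → Point d n → Set
CommonMSubspace {d} {n} M x y =
  Σ (Subset d) λ B → (B ∈ˡ M) × Σ (Point d n) λ z → InSubspace B z x × InSubspace B z y

-- A list of elements of A, no two (at distinct positions) in a common M-subspace.
-- (Such a list automatically has no repeated elements, since M is non-empty.)
IsIndependent : {d : ℕ} {n : Fin d → ℕ} (M : List (Subset d)) → GridSet d n → List (Point d n) → Set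
IsIndependent M A xs = All A xs × AllPairs (λ x y → ¬ CommonMSubspace M x y) xs

IsIndependenceNumber : {d : ℕ} {n : Fin d → ℕ} (M : List (Subset d)) → GridSet d n → ℕ → Set
IsIndependenceNumber {d} {n} M A m =
  (Σ (List (Point d n)) λ xs → IsIndependent M A xs × length xs ≡ m)
  × ((xs : List (Point d n)) → IsIndependent M A xs → length xs ≤ m)

{-# OPTIONS --safe #-}
module Submission where

-- A maximum independent list xs is also a cover once every point of it is
-- thickened to its |M| subspaces B + x (B ∈ M): a point of A outside all of
-- them shares no M-subspace with any x, so it could be added to xs.  Hence
-- c_M(A) ≤ |M| · |xs| = |M| · I_M(A).

open import Defs
open import Data.Nat using (ℕ; _≤_; _*_; _+_)
open import Data.Nat.Properties using (≤-trans; ≤-reflexive; *-suc; *-zeroʳ; n≮n)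
open import Data.Fin using (Fin; _≟_)
open import Data.Fin.Properties using (all?)
open import Data.Fin.Subset using (Subset)
open import Data.Fin.Subset.Properties using (_∈?_)
open import Data.List using (List; []; _∷_; length; concatMap)
open import Data.List.Properties using (length-++)
open import Data.List.Membership.Propositional using (mapWith∈; lose) renaming (_∈_ to _∈ˡ_)
open import Data.List.Membership.Setoid.Properties using (length-mapWith∈)
open import Data.List.Relation.Unary.All using (_∷_; tabulate)
open import Data.List.Relation.Unary.AllPairs using (_∷_)
open import Data.List.Relation.Unary.Any using (Any; any?)
open import Data.List.Relation.Unary.Any.Properties using (concatMap⁺; mapWith∈⁺)
open import Data.List.Relation.Unary.Unique.Propositional using (Unique)
open import Data.Product using (_,_)
open import Relation.Binary.PropositionalEquality
  using (_≡_; _≢_; refl; sym; trans; cong₂; setoid)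
open import Relation.Nullary using (Dec; yes; no; ¬_; ¬?; contradiction)
open import Relation.Nullary.Decidable using (_→-dec_)

length-concatMap-const : {X Y : Set} (f : X → List Y) (k : ℕ) → (∀ x → length (f x) ≡ k)
  → (xs : List X) → length (concatMap f xs) ≡ k * length xs
length-concatMap-const f k len-f [] = sym (*-zeroʳ k)
length-concatMap-const f k len-f (x ∷ xs) =
  trans (length-++ (f x))
    (trans (cong₂ _+_ (len-f x) (length-concatMap-const f k len-f xs)) (sym (*-suc k (length xs))))

module _ {d : ℕ} {n : Fin d → ℕ} (M : List (Subset d)) where

  InSubspace? : (B : Subset d) (x y : Point d n) → Dec (InSubspace B x y)
  InSubspace? B x y = all? (λ i → ¬? (i ∈? B) →-dec (y i ≟ x i))

  _∈S?_ : (y : Point d n) (S : MSubspace n M) → Dec (y ∈S S)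
  y ∈S? (B , _ , x) = InSubspace? B x y

  subspacesThrough : Point d n → List (MSubspace n M)
  subspacesThrough x = mapWith∈ M (λ {B} B∈M → B , B∈M , x)

  thickening : List (Point d n) → List (MSubspace n M)
  thickening = concatMap subspacesThrough

  length-thickening : (xs : List (Point d n)) → length (thickening xs) ≡ length M * length xs
  length-thickening = length-concatMap-const subspacesThrough (length M)
    (λ _ → length-mapWith∈ (setoid _) M)

  CommonMSubspace⇒∈subspacesThrough : {x y : Point d n} → CommonMSubspace M y x
    → Any (y ∈S_) (subspacesThrough x)
  CommonMSubspace⇒∈subspacesThrough (B , B∈M , z , z~y , z~x) =
    mapWith∈⁺ _ (B , B∈M , λ i i∉B → trans (z~y i i∉B) (sym (z~x i i∉B)))

  CommonMSubspace⇒∈thickening : {x y : Point d n} {xs : List (Point d n)} → x ∈ˡ xs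
    → CommonMSubspace M y x → Any (y ∈S_) (thickening xs)
  CommonMSubspace⇒∈thickening x∈xs common =
    concatMap⁺ subspacesThrough (lose x∈xs (CommonMSubspace⇒∈subspacesThrough common))

  module _ (A : GridSet d n) where

    independent-∷ : {y : Point d n} {xs : List (Point d n)} → IsIndependent M A xs → A y
      → ¬ Any (y ∈S_) (thickening xs) → IsIndependent M A (y ∷ xs)
    independent-∷ (xs⊆A , xs-independent) y∈A y∉thickening =
      y∈A ∷ xs⊆A ,
      tabulate (λ x∈xs common → y∉thickening (CommonMSubspace⇒∈thickening x∈xs common))
        ∷ xs-independent

    maximum-independent⇒cover : {xs : List (Point d n)} → IsIndependent M A xs
      → ((ys : List (Point d n)) → IsIndependent M A ys → length ys ≤ length xs)
      → IsCover M A (thickening xs)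
    maximum-independent⇒cover {xs} independent maximum y y∈A
      with any? (y ∈S?_) (thickening xs)
    ... | yes y∈thickening = y∈thickening
    ... | no y∉thickening = contradiction
      (maximum (y ∷ xs) (independent-∷ independent y∈A y∉thickening)) (n≮n (length xs))

lemma3p1 : (d l : ℕ) → 1 ≤ d → 1 ≤ l → (n : Fin d → ℕ) → ((i : Fin d) → 1 ≤ n i)
    → (M : List (Subset d)) → Unique M → M ≢ []
    → (A : GridSet d n) → (c m : ℕ)
    → IsCoveringNumber M A c → l ≤ c → IsIndependenceNumber M A m
    → c ≤ length M * m
lemma3p1 d l _ _ n _ M _ _ A c _ (_ , minimum) _ ((xs , independent , refl) , maximum) =
  ≤-trans (minimum (thickening M xs) (maximum-independent⇒cover M A independent maximum))
    (≤-reflexive (length-thickening M xs))
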